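{- Let $\mathbb X_i$, $i\in I$, be pairwise disjoint, connected and reversible $L_b$-structures, $\mathbb X=\bigcup_{i\in I}\mathbb X_i$ and $\mathcal X=\{\mathbb X_i:i\in I\}$. If there is $\theta\in\mathbb M(\mathcal X)$ such that for each $a\in\theta[\mathcal X]$ there is no $\omega^*$-sequence in $I^\theta_a$, then $\mathbb X$ is reversible. In particular this holds if $\langle\theta(\mathbb X_i):i\in I\rangle$ is finite-to-one, i.e. all sets $I^\theta_a$, $a\in\theta[\mathcal X]$, are finite.
   Context: An $L_b$-structure is a pair $\langle X,\rho\rangle$ with $\rho\subseteq X^2$. A homomorphism preserves the relation; a monomorphism is an injective homomorphism, a condensation a bijective homomorphism. A structure is reversible iff every condensation from it to itself is an automorphism. Components are the classes of the smallest equivalence relation containing $\rho$; connected means exactly one component. The union of disjoint structures is $\langle\bigcup X_i,\bigcup\rho_i\rangle$. Write $\mathbb Y\preccurlyeq_m\mathbb Z$ iff there is a monomorphism $\mathbb Y\to\mathbb Z$. A well founded relation is a pair $\mathcal W=\langle\mathcal A,\mathcal R\rangle$ where $\mathcal A$ is a class and $\mathcal R$ a binary class relation on $\mathcal A$ such that every non-empty set $S\subseteq\mathcal A$ has an $\mathcal R$-minimal element (some $y\in S$ with no $z\in S$, $z\mathcal R y$); write $a\le_{\mathcal R}b$ iff $a=b$ or $a\mathcal R b$. $\mathbb M(\mathcal X,\mathcal W)$ is the class of functions $\theta:\mathcal X\to\mathcal A$ with $\mathbb Y\preccurlyeq_m\mathbb Z\Rightarrow\theta(\mathbb Y)\le_{\mathcal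 R}\theta(\mathbb Z)$ for $\mathbb Y,\mathbb Z\in\mathcal X$, and $\mathbb M(\mathcal X)$ is the union of $\mathbb M(\mathcal X,\mathcal W)$ over all well founded relations $\mathcal W$. For such $\theta$ and $a$, $I^\theta_a=\{i\in I:\theta(\mathbb X_i)=a\}$. An $\omega^*$-sequence in a set $J\subseteq I$ is an injection $k\mapsto i_k$ from $\omega$ to $J$ such that $\mathbb X_{i_l}\preccurlyeq_m\mathbb X_{i_k}$ whenever $k<l$. -}

module Defs where

open import Level using (Level; _⊔_; suc)
open import Data.Nat using (ℕ; _<_)
open import Data.Product using (Σ; _×_; _,_)
open import Data.Sum using (_⊎_)
open import Data.List using (List)
open import Data.List.Membership.Propositional using (_∈_)
open import Relation.Nullary using (¬_)
open import Relation.Unary using (Pred)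
open import Relation.Binary.PropositionalEquality using (_≡_)
open import Relation.Binary.Construct.Closure.Equivalence using (EqClosure)
open import Function.Definitions using (Injective; Bijective)

record Structure (ℓ : Level) : Set (suc ℓ) where
  field
    Carrier : Set ℓ
    rel     : Carrier → Carrier → Set ℓ
open Structure public

module _ {ℓ : Level} where

  IsHom : (Y Z : Structure ℓ) → (Carrier Y → Carrier Z) → Set ℓ
  IsHom Y Z f = ∀ x y → rel Y x y → rel Z (f x) (f y)

  IsMono : (Y Z : Structure ℓ) → (Carrier Y → Carrier Z) → Set ℓ
  IsMono Y Z f = IsHom Y Z f × Injective _≡_ _≡_ f

  IsCondensation : (Y Z : Structure ℓ) → (Carrier Y → Carrier Z) → Set ℓ
  IsCondensation Y Z f = IsHom Y Z f × Bijective _≡_ _≡_ f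

  IsAutomorphism : (Y : Structure ℓ) → (Carrier Y → Carrier Y) → Set ℓ
  IsAutomorphism Y f =
    Bijective _≡_ _≡_ f × IsHom Y Y f × (∀ x y → rel Y (f x) (f y) → rel Y x y)

  Reversible : Structure ℓ → Set ℓ
  Reversible Y = ∀ (f : Carrier Y → Carrier Y) → IsCondensation Y Y f → IsAutomorphism Y f

  -- connected: exactly one component (component = class of the equivalence
  -- closure of ρ); i.e. nonempty and any two points are equivalent.
  Connected : Structure ℓ → Set ℓ
  Connected Y = Carrier Y × (∀ x y → EqClosure (rel Y) x y)

  _≼m_ : Structure ℓ → Structure ℓ → Set ℓ
  Y ≼m Z = Σ (Carrier Y → Carrier Z) (IsMono Y Z)

  -- Union of a family of pairwise disjoint structures (disjointness is
  -- built in: the carrier is the disjoint sum Σ I X_i).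
  module _ {I : Set ℓ} (X : I → Structure ℓ) where

    data UnionRel : Σ I (λ i → Carrier (X i)) → Σ I (λ i → Carrier (X i)) → Set ℓ where
      inRel : ∀ {i x y} → rel (X i) x y → UnionRel (i , x) (i , y)

    Union : Structure ℓ
    Union = record { Carrier = Σ I (λ i → Carrier (X i)) ; rel = UnionRel }

IsWellFounded : ∀ {a r} {A : Set a} → (A → A → Set r) → (p : Level) → Set (a ⊔ r ⊔ suc p)
IsWellFounded {A = A} R p =
  ∀ (S : Pred A p) → Σ A S → Σ A (λ y → S y × (∀ z → S z → ¬ R z y))

_≤[_]_ : ∀ {a r} {A : Set a} → A → (A → A → Set r) → A → Set (a ⊔ r)
x ≤[ R ] y = x ≡ y ⊎ R x y

module _ {ℓ a r : Level} {I : Set ℓ} (X : I → Structure ℓ) {A : Set a} (R : A → A → Set r) where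

  -- θ ∈ M(𝒳, ⟨A,R⟩) (θ given on the index set; 𝒳 = {X_i : i ∈ I})
  IsMonotoneRank : (I → A) → Set (ℓ ⊔ a ⊔ r)
  IsMonotoneRank θ = ∀ i j → X i ≼m X j → θ i ≤[ R ] θ j

module _ {ℓ : Level} {I : Set ℓ} (X : I → Structure ℓ) where

  OmegaStarSeq : ∀ {p} → Pred I p → Set (ℓ ⊔ p)
  OmegaStarSeq J =
    Σ (ℕ → I) λ s → Injective _≡_ _≡_ s × (∀ k → J (s k))
      × (∀ k l → k < l → X (s l) ≼m X (s k))

  Fiber : ∀ {a} {A : Set a} → (I → A) → A → Pred I a
  Fiber θ x i = θ i ≡ x

FiniteSubset : ∀ {ℓ p} {I : Set ℓ} → Pred I p → Set (ℓ ⊔ p)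
FiniteSubset {I = I} J = Σ (List I) λ xs → ∀ j → J j → j ∈ xs

module Submission where

-- A condensation f of X = ⋃ X_i maps each connected X_i into one component
-- X_(g i).  Iterated f-preimages of a point of X_i give a backward g-orbit of
-- components, each embedding (by f) into its predecessor.  If i were not
-- g-periodic this chain would be injective; a monotone rank θ into a
-- well-founded relation stabilises along it, so its tail is an ω*-sequence in
-- one fibre of θ.  Excluding that, every i is g-periodic, hence g is injective;
-- so ρ(f z, f w) puts z, w in one X_i, where f^P (P a period of i) restricts to
-- a self-condensation, an automorphism by reversibility of X_i, giving ρ(z, w).
-- Finite fibres carry no ω*-sequence by pigeonhole.

open import Defs
open import Level using (Level; _⊔_; Lift; lift)
open import Data.Product using (Σ; ∃; _×_; _,_; proj₁; proj₂)
open import Data.Product.Properties using (Σ-≡,≡→≡; ,-injectiveʳ-UIP)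
open import Data.Sum using (inj₁; inj₂)
open import Data.Nat using (ℕ; zero; suc; _+_; _*_; _<_; _≤_; _≤‴_; ≤‴-refl; ≤‴-step)
open import Data.Nat.Properties
  using (+-comm; *-comm; +-identityʳ; +-cancelʳ-≡; <-cmp; <⇒≤; <⇒≢; ≤⇒≤‴; m≤n⇒∃[o]m+o≡n; n<1+n)
open import Data.Nat.GeneralisedArithmetic using (iterate)
open import Data.Fin using (Fin; toℕ)
open import Data.Fin.Properties using (pigeonhole)
open import Data.List using (length; lookup)
open import Data.List.Relation.Unary.Any using (index)
open import Data.List.Relation.Unary.Any.Properties using (lookup-index)
open import Data.Empty using (⊥; ⊥-elim)
open import Relation.Nullary using (¬_; yes; no)
open import Relation.Unary using (Pred)
open import Relation.Binary using (tri<; tri≈; tri>)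
open import Relation.Binary.PropositionalEquality
open import Relation.Binary.Construct.Closure.Equivalence using (gfold)
open import Function.Definitions using (Injective; Surjective)
import Function.Construct.Composition as Compose
import Function.Construct.Identity as Identity
open import Axiom.ExcludedMiddle using (ExcludedMiddle)
open import Axiom.UniquenessOfIdentityProofs.WithK using (uip)

-- a positive gap between k < l, in the form in which iteration unfolds it
positive-gap : ∀ {k l} → k < l → ∃ λ e → suc e + k ≡ l
positive-gap {k} k<l with m≤n⇒∃[o]m+o≡n k<l
... | e , k+1+e≡l = e , trans (cong suc (+-comm e k)) k+1+e≡l

module _ {a} {A : Set a} (f : A → A) where

  iterate-+ : ∀ x m n → iterate f x (m + n) ≡ iterate f (iterate f x m) n
  iterate-+ x zero    n = refl
  iterate-+ x (suc m) n = iterate-+ (f x) m n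

  iterate-comm : ∀ x m n → iterate f (iterate f x m) n ≡ iterate f (iterate f x n) m
  iterate-comm x m n = begin
    iterate f (iterate f x m) n  ≡⟨ iterate-+ x m n ⟨
    iterate f x (m + n)          ≡⟨ cong (iterate f x) (+-comm m n) ⟩
    iterate f x (n + m)          ≡⟨ iterate-+ x n m ⟩
    iterate f (iterate f x n) m  ∎
    where open ≡-Reasoning

  iterate-injective : Injective _≡_ _≡_ f → ∀ n → Injective _≡_ _≡_ (λ x → iterate f x n)
  iterate-injective f-inj zero    eq = eq
  iterate-injective f-inj (suc n) eq = f-inj (iterate-injective f-inj n eq)

  iterate-semiconj : ∀ {b} {B : Set b} {h : B → B} (p : A → B) →
    (∀ x → p (f x) ≡ h (p x)) → ∀ n x → p (iterate f x n) ≡ iterate h (p x) n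
  iterate-semiconj p p∘f≡h∘p zero    x = refl
  iterate-semiconj {h = h} p p∘f≡h∘p (suc n) x =
    trans (iterate-semiconj p p∘f≡h∘p n (f x)) (cong (λ y → iterate h y n) (p∘f≡h∘p x))

  Periodic : A → Set a
  Periodic x = ∃ λ e → iterate f x (suc e) ≡ x

  period-multiple : ∀ {x} P → iterate f x P ≡ x → ∀ c → iterate f x (c * P) ≡ x
  period-multiple         P returns zero    = refl
  period-multiple {x = x} P returns (suc c) = begin
    iterate f x (P + c * P)            ≡⟨ iterate-+ x P (c * P) ⟩
    iterate f (iterate f x P) (c * P)  ≡⟨ cong (λ y → iterate f y (c * P)) returns ⟩
    iterate f x (c * P)                ≡⟨ period-multiple P returns c ⟩
    x                                  ∎
    where open ≡-Reasoning

  periodic-iterate : ∀ {x} → Periodic x → ∀ n → Periodic (iterate f x n)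
  periodic-iterate {x} (e , returns) n = e , (begin
    iterate f (iterate f x n) (suc e)  ≡⟨ iterate-comm x n (suc e) ⟩
    iterate f (iterate f x (suc e)) n  ≡⟨ cong (λ y → iterate f y n) returns ⟩
    iterate f x n                      ∎)
    where open ≡-Reasoning

  -- if every point is periodic, f is injective: after the product of the
  -- periods of x and y both points are back, and f x = f y lies on the way
  all-periodic⇒injective : (∀ x → Periodic x) → Injective _≡_ _≡_ f
  all-periodic⇒injective periodic {x} {y} fx≡fy
    with periodic x | periodic y
  ... | d , x-returns | e , y-returns = begin
    x                            ≡⟨ period-multiple (suc d) x-returns (suc e) ⟨
    iterate f x (suc e * suc d)  ≡⟨ cong (iterate f x) (*-comm (suc e) (suc d)) ⟩
    iterate f x (suc d * suc e)  ≡⟨ cong (λ z → iterate f z (e + d * suc e)) fx≡fy ⟩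
    iterate f y (suc d * suc e)  ≡⟨ period-multiple (suc e) y-returns (suc d) ⟩
    y                            ∎
    where open ≡-Reasoning

  module _ {c : ℕ → A} (backward : ∀ n → f (c (suc n)) ≡ c n) where

    orbit-reaches : ∀ d n → iterate f (c (d + n)) d ≡ c n
    orbit-reaches zero    n = refl
    orbit-reaches (suc d) n =
      trans (cong (λ y → iterate f y d) (backward (d + n))) (orbit-reaches d n)

    orbit-repeat⇒periodic : ∀ {k l} → k < l → c l ≡ c k → Periodic (c 0)
    orbit-repeat⇒periodic {k} k<l repeat with positive-gap k<l
    ... | e , refl = subst Periodic reaches-start (periodic-iterate ck-periodic k)
      where
      ck-periodic : Periodic (c k)
      ck-periodic = e , trans (cong (λ y → iterate f y (suc e)) (sym repeat))
                              (orbit-reaches (suc e) k)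
      reaches-start : iterate f (c k) k ≡ c 0
      reaches-start =
        trans (cong (λ t → iterate f (c t) k) (sym (+-identityʳ k))) (orbit-reaches k 0)

    aperiodic⇒orbit-injective : ¬ Periodic (c 0) → Injective _≡_ _≡_ c
    aperiodic⇒orbit-injective aperiodic {k} {l} ck≡cl with <-cmp k l
    ... | tri< k<l _ _ = ⊥-elim (aperiodic (orbit-repeat⇒periodic k<l (sym ck≡cl)))
    ... | tri≈ _ k≡l _ = k≡l
    ... | tri> _ _ l<k = ⊥-elim (aperiodic (orbit-repeat⇒periodic l<k ck≡cl))

finite⇒no-injective-sequence : ∀ {ℓ p} {I : Set ℓ} {J : Pred I p} → FiniteSubset J →
  (s : ℕ → I) → Injective _≡_ _≡_ s → (∀ k → J (s k)) → ⊥
finite⇒no-injective-sequence (xs , covers) s s-inj s∈J =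
  let k , l , k<l , same-position = pigeonhole (n<1+n (length xs)) position
  in <⇒≢ k<l (s-inj (begin
    s (toℕ k)               ≡⟨ located k ⟩
    lookup xs (position k)  ≡⟨ cong (lookup xs) same-position ⟩
    lookup xs (position l)  ≡⟨ located l ⟨
    s (toℕ l)               ∎))
  where
  open ≡-Reasoning
  position : Fin (suc (length xs)) → Fin (length xs)
  position k = index (covers (s (toℕ k)) (s∈J (toℕ k)))
  located : ∀ k → s (toℕ k) ≡ lookup xs (position k)
  located k = lookup-index (covers (s (toℕ k)) (s∈J (toℕ k)))

finite⇒no-ω*-sequence : ∀ {ℓ p} {I : Set ℓ} (X : I → Structure ℓ) {J : Pred I p} →
  FiniteSubset J → ¬ OmegaStarSeq X J
finite⇒no-ω*-sequence X finite (s , s-inj , s∈J , _) =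
  finite⇒no-injective-sequence finite s s-inj s∈J

descending-stabilises : ∀ {a r p} {A : Set a} (R : A → A → Set r) → IsWellFounded R (a ⊔ p) →
  (u : ℕ → A) → (∀ n → u (suc n) ≤[ R ] u n) → ∃ λ m → ∀ t → u (t + m) ≡ u m
descending-stabilises {p = p} R wf u descending
  with wf (λ y → Lift p (∃ λ n → u n ≡ y)) (u 0 , lift (0 , refl))
... | _ , lift (m , refl) , minimal = m , stable
  where
  -- a strict descent below u m would contradict its minimality
  stable : ∀ t → u (t + m) ≡ u m
  stable zero    = refl
  stable (suc t) with descending (t + m)
  ... | inj₁ same    = trans same (stable t)
  ... | inj₂ smaller =
    ⊥-elim (minimal _ (lift (suc t + m , refl)) (subst (R _) (stable t) smaller))

module _ {ℓ : Level} where

  ≼m-refl : {Y : Structure ℓ} → Y ≼m Y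
  ≼m-refl = (λ x → x) , (λ x y r → r) , (λ eq → eq)

  ≼m-trans : {Y Z W : Structure ℓ} → Y ≼m Z → Z ≼m W → Y ≼m W
  ≼m-trans (h , h-hom , h-inj) (k , k-hom , k-inj) =
    (λ x → k (h x)) , (λ x y r → k-hom _ _ (h-hom x y r)) , (λ eq → h-inj (k-inj eq))

  descending-≼ : (Y : ℕ → Structure ℓ) → (∀ n → Y (suc n) ≼m Y n) →
    ∀ {k l} → k ≤ l → Y l ≼m Y k
  descending-≼ Y step k≤l = along (≤⇒≤‴ k≤l)
    where
    along : ∀ {k l} → k ≤‴ l → Y l ≼m Y k
    along ≤‴-refl          = ≼m-refl
    along {k} {l} (≤‴-step k+1≤l) = ≼m-trans {Y l} {Y (suc k)} {Y k} (along k+1≤l) (step k)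

  condensation-iterate : {Y : Structure ℓ} {h : Carrier Y → Carrier Y} →
    IsCondensation Y Y h → ∀ n → IsCondensation Y Y (λ x → iterate h x n)
  condensation-iterate h-cond zero = (λ x y r → r) , Identity.bijective _≡_
  condensation-iterate {h = h} (h-hom , h-bij) (suc n)
    with condensation-iterate (h-hom , h-bij) n
  ... | hⁿ-hom , hⁿ-bij =
    (λ x y r → hⁿ-hom _ _ (h-hom x y r)) , Compose.bijective _≡_ _≡_ _≡_ h-bij hⁿ-bij

union-rel-component : ∀ {ℓ} {I : Set ℓ} {X : I → Structure ℓ} {z w} →
  UnionRel X z w → proj₁ z ≡ proj₁ w
union-rel-component (inRel r) = refl

union-rel-inv : ∀ {ℓ} {I : Set ℓ} {X : I → Structure ℓ} {i x y} →
  UnionRel X (i , x) (i , y) → rel (X i) x y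
union-rel-inv (inRel r) = r

hom-respects-components : ∀ {ℓ} {I J : Set ℓ} {X : I → Structure ℓ} {Y : J → Structure ℓ}
  (h : Carrier (Union X) → Carrier (Union Y)) → IsHom (Union X) (Union Y) h →
  ∀ {i} → Connected (X i) → ∀ x y → proj₁ (h (i , x)) ≡ proj₁ (h (i , y))
hom-respects-components h h-hom {i} (_ , linked) x y =
  gfold isEquivalence (λ x → proj₁ (h (i , x)))
        (λ r → union-rel-component (h-hom _ _ (inRel r))) (linked x y)

module Restriction {ℓ : Level} {I J : Set ℓ} (X : I → Structure ℓ) (Y : J → Structure ℓ)
  (h : Carrier (Union X) → Carrier (Union Y)) {i : I} {k : J}
  (lands : ∀ x → proj₁ (h (i , x)) ≡ k) where

  restrict : Carrier (X i) → Carrier (Y k)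
  restrict x = subst (λ j → Carrier (Y j)) (lands x) (proj₂ (h (i , x)))

  restrict-spec : ∀ x → h (i , x) ≡ (k , restrict x)
  restrict-spec x = Σ-≡,≡→≡ (lands x , refl)

  restrict-rel : ∀ {x y} → rel (Union Y) (h (i , x)) (h (i , y)) → rel (Y k) (restrict x) (restrict y)
  restrict-rel {x} {y} r = union-rel-inv (subst₂ (UnionRel Y) (restrict-spec x) (restrict-spec y) r)

  restrict-mono : IsMono (Union X) (Union Y) h → IsMono (X i) (Y k) restrict
  restrict-mono (h-hom , h-inj) = (λ x y r → restrict-rel (h-hom _ _ (inRel r))) , restrict-inj
    where
    restrict-inj : Injective _≡_ _≡_ restrict
    restrict-inj {x} {y} eq = ,-injectiveʳ-UIP uip (h-inj (begin
      h (i , x)         ≡⟨ restrict-spec x ⟩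
      (k , restrict x)  ≡⟨ cong (k ,_) eq ⟩
      (k , restrict y)  ≡⟨ restrict-spec y ⟨
      h (i , y)         ∎))
      where open ≡-Reasoning

  restrict-surjective : Surjective _≡_ _≡_ h →
    (∀ {i′} x′ → proj₁ (h (i′ , x′)) ≡ k → i′ ≡ i) → Surjective _≡_ _≡_ restrict
  restrict-surjective h-surj from-i y with h-surj (k , y)
  ... | (i′ , x′) , hits with from-i x′ (cong proj₁ (hits refl))
  ... | refl = x′ , λ { refl → ,-injectiveʳ-UIP uip (trans (sym (restrict-spec x′)) (hits refl)) }

  restrict-condensation : IsCondensation (Union X) (Union Y) h →
    (∀ {i′} x′ → proj₁ (h (i′ , x′)) ≡ k → i′ ≡ i) → IsCondensation (X i) (Y k) restrict
  restrict-condensation (h-hom , h-inj , h-surj) from-i with restrict-mono (h-hom , h-inj)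
  ... | r-hom , r-inj = r-hom , r-inj , restrict-surjective h-surj from-i

NoInjectiveDescendingChain : ∀ {ℓ} {I : Set ℓ} → (I → Structure ℓ) → Set ℓ
NoInjectiveDescendingChain {I = I} X =
  ∀ (c : ℕ → I) → Injective _≡_ _≡_ c → (∀ n → X (c (suc n)) ≼m X (c n)) → ⊥

module ComponentMap {ℓ : Level} {I : Set ℓ} (X : I → Structure ℓ)
  (connected : ∀ i → Connected (X i))
  (f : Carrier (Union X) → Carrier (Union X)) (condensation : IsCondensation (Union X) (Union X) f)
  where

  U : Structure ℓ
  U = Union X

  f-mono : IsMono U U f
  f-mono = proj₁ condensation , proj₁ (proj₂ condensation)

  base : ∀ i → Carrier (X i)
  base i = proj₁ (connected i)

  -- f maps X i into the single component X (g i)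
  g : I → I
  g i = proj₁ (f (i , base i))

  f-over-g : ∀ z → proj₁ (f z) ≡ g (proj₁ z)
  f-over-g (i , x) = hom-respects-components f (proj₁ condensation) (connected i) x (base i)

  -- repeated f-preimages of the base point of X i; their components form a
  -- backward g-orbit of i along which the components embed (by f) into their predecessors
  module BackwardOrbit (i : I) where

    point : ℕ → Carrier U
    point zero    = i , base i
    point (suc n) = proj₁ (proj₂ (proj₂ condensation) (point n))

    component : ℕ → I
    component n = proj₁ (point n)

    g-component : ∀ n → g (component (suc n)) ≡ component n
    g-component n = trans (sym (f-over-g (point (suc n))))
                          (cong proj₁ (proj₂ (proj₂ (proj₂ condensation) (point n)) refl))

    component-descending : ∀ n → X (component (suc n)) ≼m X (component n)
    component-descending n = restrict , restrict-mono f-mono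
      where open Restriction X X f (λ x → trans (f-over-g (component (suc n) , x)) (g-component n))

  -- without injective descending chains, the backward orbit of i repeats, so i is g-periodic
  components-periodic : ExcludedMiddle ℓ → NoInjectiveDescendingChain X → ∀ i → Periodic g i
  components-periodic lem no-chain i with lem {Periodic g i}
  ... | yes periodic = periodic
  ... | no aperiodic  =
    ⊥-elim (no-chain component (aperiodic⇒orbit-injective g g-component aperiodic)
                     component-descending)
    where open BackwardOrbit i

  module _ (reversible : ∀ i → Reversible (X i)) (periodic : ∀ i → Periodic g i) where

    g-injective : Injective _≡_ _≡_ g
    g-injective = all-periodic⇒injective g periodic

    -- f^P, for P a period of i, restricts to a self-condensation of X i
    module Return (i : I) where

      P : ℕ
      P = suc (proj₁ (periodic i))

      f^-over-g^ : ∀ z → proj₁ (iterate f z P) ≡ iterate g (proj₁ z) P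
      f^-over-g^ = iterate-semiconj f proj₁ f-over-g P

      open Restriction X X (λ z → iterate f z P) (λ x → trans (f^-over-g^ (i , x)) (proj₂ (periodic i)))
        public

      return-condensation : IsCondensation (X i) (X i) restrict
      return-condensation = restrict-condensation (condensation-iterate condensation P) from-i
        where
        from-i : ∀ {i′} x′ → proj₁ (iterate f (i′ , x′) P) ≡ i → i′ ≡ i
        from-i x′ lands = iterate-injective g g-injective P
          (trans (sym (f^-over-g^ (_ , x′))) (trans lands (sym (proj₂ (periodic i)))))

    -- ρ (f z) (f w) forces z, w into one component X i (g is injective); there
    -- f^P is an automorphism by reversibility of X i, and it relates the images
    f-reflects : ∀ z w → rel U (f z) (f w) → rel U z w
    f-reflects (i , x) (i′ , y) fz~fw
      with g-injective (trans (sym (f-over-g (i , x)))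
                              (trans (union-rel-component fz~fw) (f-over-g (i′ , y))))
    ... | refl = inRel (restrict-reflects x y (restrict-rel f^P-related))
      where
      open Return i
      restrict-reflects : ∀ x y → rel (X i) (restrict x) (restrict y) → rel (X i) x y
      restrict-reflects = proj₂ (proj₂ (reversible i restrict return-condensation))
      f^P-related : rel U (iterate f (i , x) P) (iterate f (i , y) P)
      f^P-related = proj₁ (condensation-iterate condensation (proj₁ (periodic i))) _ _ fz~fw

no-descending-chain⇒reversible : ∀ {ℓ} {I : Set ℓ} → ExcludedMiddle ℓ → (X : I → Structure ℓ) →
  (∀ i → Connected (X i)) → (∀ i → Reversible (X i)) →
  NoInjectiveDescendingChain X → Reversible (Union X)
no-descending-chain⇒reversible lem X connected reversible no-chain f condensation =
  proj₂ condensation , proj₁ condensation ,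
  f-reflects reversible (components-periodic lem no-chain)
  where open ComponentMap X connected f condensation

-- a monotone rank is eventually constant on an injective descending chain,
-- whose tail is then an ω*-sequence inside a single fibre
descending-chain⇒ω* : ∀ {ℓ a r} {I : Set ℓ} (X : I → Structure ℓ) {A : Set a}
  (R : A → A → Set r) → IsWellFounded R (ℓ ⊔ a ⊔ r) → (θ : I → A) → IsMonotoneRank X R θ →
  (c : ℕ → I) → Injective _≡_ _≡_ c → (∀ n → X (c (suc n)) ≼m X (c n)) →
  ∃ λ m → OmegaStarSeq X (Fiber X θ (θ (c m)))
descending-chain⇒ω* {ℓ} {r = r} X R wf θ monotone c c-inj descending
  with descending-stabilises {p = ℓ ⊔ r} R wf (λ n → θ (c n))
         (λ n → monotone _ _ (descending n))
... | m , stable =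
  m , (λ k → c (k + m)) , (λ eq → +-cancelʳ-≡ m _ _ (c-inj eq)) , stable ,
  λ k l k<l → descending-≼ (λ k → X (c (k + m))) (λ k → descending (k + m)) (<⇒≤ k<l)

rank-criterion : ∀ {ℓ a r} {I : Set ℓ} → ExcludedMiddle ℓ → (X : I → Structure ℓ) →
  (∀ i → Connected (X i)) → (∀ i → Reversible (X i)) →
  ∀ {A : Set a} (R : A → A → Set r) → IsWellFounded R (ℓ ⊔ a ⊔ r) →
  (θ : I → A) → IsMonotoneRank X R θ →
  (∀ x → Σ I (λ i → θ i ≡ x) → ¬ OmegaStarSeq X (Fiber X θ x)) → Reversible (Union X)
rank-criterion lem X connected reversible R wf θ monotone no-ω* =
  no-descending-chain⇒reversible lem X connected reversible λ c c-inj descending →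
    let m , ω* = descending-chain⇒ω* X R wf θ monotone c c-inj descending
    in no-ω* (θ (c m)) (c m , refl) ω*

theorem4p1 : (lem : ∀ {p} → ExcludedMiddle p)
    → ∀ {ℓ a r : Level} {I : Set ℓ} (X : I → Structure ℓ)
    → (∀ i → Connected (X i)) → (∀ i → Reversible (X i))
    → (∀ {A : Set a} (R : A → A → Set r) → IsWellFounded R (ℓ ⊔ a ⊔ r)
         → (θ : I → A) → IsMonotoneRank X R θ
         → (∀ x → Σ I (λ i → θ i ≡ x) → ¬ OmegaStarSeq X (Fiber X θ x))
         → Reversible (Union X))
      × (∀ {A : Set a} (R : A → A → Set r) → IsWellFounded R (ℓ ⊔ a ⊔ r)
         → (θ : I → A) → IsMonotoneRank X R θ
         → (∀ x → Σ I (λ i → θ i ≡ x) → FiniteSubset (Fiber X θ x))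
         → Reversible (Union X))
theorem4p1 lem X connected reversible =
  rank-criterion lem X connected reversible ,
  λ R wf θ monotone finite-fibres →
    rank-criterion lem X connected reversible R wf θ monotone
      (λ x inhabited → finite⇒no-ω*-sequence X (finite-fibres x inhabited))
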